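{- Let $\mathbb{F}_q$ be a finite field, $a,b\in\mathbb{F}_q$ with $b\neq0$, and $Q=\begin{pmatrix} a & b\\ 1 & 0\end{pmatrix}$, and suppose $x^2-ax-b$ is irreducible over $\mathbb{F}_q$. Then the number of non-trivial orbits of $G=\langle Q\rangle$ acting on $\mathbb{F}_q\times\mathbb{F}_q$ is at least $\frac{q-1}{2|b^2|}$, where $|b^2|$ is the multiplicative order of $b^2$ in $\mathbb{F}_q^\times$.
   Context: $G=\langle Q\rangle$ acts on $\mathbb{F}_q\times\mathbb{F}_q$ (column vectors) by $v\mapsto Q^nv$; non-trivial orbits are orbits of non-zero vectors. -}

module Defs where

open import Level using (Level; _⊔_; suc)
open import Algebra.Bundles using (CommutativeRing)
open import Data.Nat using (ℕ; zero; suc; _≤_; _<_)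
open import Data.Fin using (Fin)
open import Data.Product using (Σ; ∃; _×_; _,_)
open import Data.Sum using (_⊎_)
open import Data.List using (List; length; lookup)
open import Data.List.Membership.Propositional using (_∈_)
open import Data.List.Relation.Unary.All using (All)
open import Relation.Binary.PropositionalEquality using (_≡_)
open import Relation.Nullary using (¬_)

record Field (c ℓ : Level) : Set (Level.suc (c ⊔ ℓ)) where
  field
    commRing : CommutativeRing c ℓ
  open CommutativeRing commRing public
  field
    1≉0     : ¬ (1# ≈ 0#)
    inverse : ∀ x → ¬ (x ≈ 0#) → ∃ λ y → x * y ≈ 1#

record FiniteField (c ℓ : Level) : Set (Level.suc (c ⊔ ℓ)) where
  field
    field′ : Field c ℓ
  open Field field′ public
  field
    q      : ℕ
    enum   : Fin q → Carrier
    enum-injective  : ∀ i j → enum i ≈ enum j → i ≡ j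
    enum-surjective : ∀ x → ∃ λ i → enum i ≈ x

module _ {c ℓ} (F : FiniteField c ℓ) where
  open FiniteField F

  Vec2 : Set c
  Vec2 = Carrier × Carrier

  _≈₂_ : Vec2 → Vec2 → Set ℓ
  (x , y) ≈₂ (x' , y') = (x ≈ x') × (y ≈ y')

  pow : Carrier → ℕ → Carrier
  pow x zero    = 1#
  pow x (suc n) = x * pow x n

  -- multiplication by Q = [[a , b] , [1 , 0]] :  (x , y) ↦ (a x + b y , x)
  Qmul : Carrier → Carrier → Vec2 → Vec2
  Qmul a b (x , y) = (a * x + b * y , x)

  Qpow : Carrier → Carrier → ℕ → Vec2 → Vec2
  Qpow a b zero    v = v
  Qpow a b (suc n) v = Qmul a b (Qpow a b n v)

  -- w lies in the orbit of v under G = ⟨Q⟩ = { Q^n | n ∈ ℤ }: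
  -- w = Q^n v (n ≥ 0) or w = Q^(-n) v, i.e. Q^n w = v (n ≥ 0).
  InOrbit : Carrier → Carrier → Vec2 → Vec2 → Set ℓ
  InOrbit a b v w = ∃ λ (n : ℕ) → (Qpow a b n v ≈₂ w) ⊎ (Qpow a b n w ≈₂ v)

  NonZero₂ : Vec2 → Set ℓ
  NonZero₂ v = ¬ (v ≈₂ (0# , 0#))

  -- Its length is the number of
  -- non-trivial orbits.
  record OrbitRepresentatives (a b : Carrier) (L : List Vec2) : Set (c ⊔ ℓ) where
    field
      nonzero  : All NonZero₂ L
      distinct : ∀ {i j : Fin (length L)} →
                 InOrbit a b (lookup L i) (lookup L j) → i ≡ j
      covers   : ∀ w → NonZero₂ w → ∃ λ v → (v ∈ L) × InOrbit a b v w

  -- x² - a x - b is irreducible: it is not a product (u x + v)(s x + t) of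
  -- two polynomials of degree ≥ 1 (necessarily of degree exactly 1).
  Irreducible-x²-ax-b : Carrier → Carrier → Set (c ⊔ ℓ)
  Irreducible-x²-ax-b a b =
    ¬ (∃ λ u → ∃ λ v → ∃ λ s → ∃ λ t →
         ¬ (u ≈ 0#) × ¬ (s ≈ 0#) ×
         (u * s ≈ 1#) × (u * t + v * s ≈ - a) × (v * t ≈ - b))

  IsMultOrder : Carrier → ℕ → Set ℓ
  IsMultOrder x m = (0 < m) × (pow x m ≈ 1#) × (∀ k → 0 < k → pow x k ≈ 1# → m ≤ k)

-- Via v = (x , y) ↦ x α + b y, F² becomes K = F[α]/(α² - a α - b) and Q becomes
-- multiplication by α.  The q + 1 lines of K are spanned by 1 and the t + α (t ∈ F),
-- which are units because irreducibility keeps their norms non-zero.  Multiplication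
-- by α permutes these lines, α (t + α) = sₜ (t′ + α); multiplying all q + 1 such
-- relations and cancelling the product of the representatives gives α^(q+1) = H ∈ F
-- (the same trick, applied to the non-zero elements of F, proves Fermat).  Taking
-- norms, H² = (- b)^(q+1) = b², so Q^(2m(q+1)) = 1 with m the order of b².  Hence
-- each non-trivial orbit has at most 2m(q+1) elements, q² - 1 ≤ 2m(q+1) · #orbits,
-- and dividing by q + 1 gives the bound.

module Submission where

open import Defs
open import Level using (Level)
import Data.Nat as ℕ
open import Data.Nat using (ℕ; _∸_; _≤_)
open import Data.List using (List; length)
open import Relation.Nullary using (¬_)
open import Algebra.Bundles using (CommutativeMonoid)
open import Data.Empty using (⊥-elim)
open import Data.Fin as Fin using (Fin; zero; suc; punchIn; punchOut; toℕ; fromℕ<; combine; remQuot)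
open import Data.Fin.Permutation using (Permutation; permutation)
open import Data.Fin.Properties
  using (any?; injective⇒≤; punchOut-injective; punchIn-injective; punchInᵢ≢i; punchIn-punchOut;
         combine-surjective; remQuot-combine; toℕ-fromℕ<)
open import Data.List using (lookup)
open import Data.List.Relation.Unary.Any as Any using ()
open import Data.List.Relation.Unary.Any.Properties using (lookup-index)
open import Data.Nat using (zero; suc; z≤n; s≤s⁻¹; _<_; NonZero)
open import Data.Nat.DivMod using (_%_; _/_; m≡m%n+[m/n]*n; m%n<n)
import Data.Nat.Properties as ℕₚ
open import Data.Nat.Tactic.RingSolver using (solve-∀)
open import Data.Product using (∃; ∃₂; _×_; _,_; proj₁; proj₂)
open import Data.Product.Relation.Binary.Pointwise.NonDependent using (×-isEquivalence)
open import Data.Sum using (inj₁; inj₂)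
open import Function using (_∘_)
open import Function.Definitions using (Injective)
open import Relation.Binary using (Decidable; IsEquivalence)
open import Relation.Binary.PropositionalEquality as ≡ using (_≡_; _≢_)
open import Relation.Nullary using (yes; no; _×-dec_)
import Relation.Binary.Reasoning.Setoid as SetoidReasoning

injective⇒surjective : ∀ {n} (π : Fin n → Fin n) → Injective _≡_ _≡_ π →
                       ∀ j → ∃ λ i → π i ≡ j
injective⇒surjective {zero}  π π-inj ()
injective⇒surjective {suc n} π π-inj j with any? (λ i → π i Fin.≟ j)
... | yes hit = hit
... | no miss = ⊥-elim (ℕₚ.1+n≰n (injective⇒≤ {f = avoid-j} avoid-j-injective))
  where
  avoid-j : Fin (suc n) → Fin n
  avoid-j i = punchOut {i = j} {j = π i} (λ j≡πi → miss (i , ≡.sym j≡πi))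

  avoid-j-injective : Injective _≡_ _≡_ avoid-j
  avoid-j-injective eq = π-inj (punchOut-injective {i = j} _ _ eq)

injective⇒permutation : ∀ {n} (π : Fin n → Fin n) → Injective _≡_ _≡_ π → Permutation n n
injective⇒permutation {n} π π-inj =
  permutation π π⁻¹ (λ j → proj₂ (surj j)) (λ i → π-inj (proj₂ (surj (π i))))
  where
  surj : ∀ j → ∃ λ i → π i ≡ j
  surj = injective⇒surjective π π-inj
  π⁻¹ : Fin n → Fin n
  π⁻¹ j = proj₁ (surj j)

surjective⇒≤ : ∀ {m n} (f : Fin m → Fin n) → (∀ j → ∃ λ i → f i ≡ j) → n ≤ m
surjective⇒≤ {m} {n} f f-surj = injective⇒≤ {f = section} section-injective
  where
  section : Fin n → Fin m
  section j = proj₁ (f-surj j)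
  section-injective : Injective _≡_ _≡_ section
  section-injective {j} {k} eq =
    ≡.trans (≡.sym (proj₂ (f-surj j))) (≡.trans (≡.cong f eq) (proj₂ (f-surj k)))

module CommutativeMonoidUnits {a ℓ} (M : CommutativeMonoid a ℓ) where
  open CommutativeMonoid M
  open import Algebra.Definitions _≈_ using (RightInvertible)
  open import Algebra.Definitions.RawMonoid rawMonoid using () renaming (_×_ to _×ⁿ_)
  open import Algebra.Properties.CommutativeMonoid.Sum M using (sum-permute; ∑-distrib-+)
  open import Algebra.Properties.CommutativeMonoid.Sum M public using () renaming (sum to ∏)
  open import Algebra.Properties.Monoid.Sum monoid using (sum-cong-≋; sum-replicate)
  open import Algebra.Properties.Monoid.Sum monoid public using ()
    renaming (sum-replicate-zero to ∏-replicate-ε)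
  open import Algebra.Properties.Monoid monoid using (cancelʳ)
  open import Algebra.Properties.Monoid.Mult monoid using (×-assocˡ; ×-congˡ)
  open import Algebra.Properties.Monoid.Mult monoid public using () renaming (×-congʳ to ^-congˡ)
  open import Algebra.Properties.CommutativeSemigroup commutativeSemigroup using (interchange)
  open SetoidReasoning setoid

  infixr 8 _^_
  _^_ : Carrier → ℕ → Carrier
  x ^ n = n ×ⁿ x

  Unit : Carrier → Set _
  Unit = RightInvertible ε _∙_

  unit-∙ : ∀ {x y} → Unit x → Unit y → Unit (x ∙ y)
  unit-∙ {x} {y} (x⁻¹ , xx⁻¹≈ε) (y⁻¹ , yy⁻¹≈ε) = x⁻¹ ∙ y⁻¹ , (begin
    (x ∙ y) ∙ (x⁻¹ ∙ y⁻¹) ≈⟨ interchange x y x⁻¹ y⁻¹ ⟩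
    (x ∙ x⁻¹) ∙ (y ∙ y⁻¹) ≈⟨ ∙-cong xx⁻¹≈ε yy⁻¹≈ε ⟩
    ε ∙ ε                 ≈⟨ identityˡ ε ⟩
    ε                     ∎)

  ^-assocʳ : ∀ x m n → (x ^ m) ^ n ≈ x ^ (m ℕ.* n)
  ^-assocʳ x m n = trans (×-assocˡ x n m) (×-congˡ (ℕₚ.*-comm n m))

  factor-of-unit : ∀ {x y u} → x ∙ y ≈ u → Unit u → Unit x
  factor-of-unit {x} {y} {u} xy≈u (v , uv≈ε) = y ∙ v , (begin
    x ∙ (y ∙ v)   ≈⟨ assoc x y v ⟨
    (x ∙ y) ∙ v   ≈⟨ ∙-congʳ xy≈u ⟩
    u ∙ v         ≈⟨ uv≈ε ⟩
    ε             ∎)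

  unit-∏ : ∀ {n} (r : Fin n → Carrier) → (∀ i → Unit (r i)) → Unit (∏ r)
  unit-∏ {zero}  r units = ε , identityˡ ε
  unit-∏ {suc n} r units = unit-∙ (units zero) (unit-∏ (λ i → r (suc i)) (λ i → units (suc i)))

  ∙-cancelʳ-unit : ∀ {u x y} → Unit u → x ∙ u ≈ y ∙ u → x ≈ y
  ∙-cancelʳ-unit {u} {x} {y} (u⁻¹ , uu⁻¹≈ε) xu≈yu = begin
    x               ≈⟨ cancelʳ uu⁻¹≈ε x ⟨
    (x ∙ u) ∙ u⁻¹   ≈⟨ ∙-congʳ xu≈yu ⟩
    (y ∙ u) ∙ u⁻¹   ≈⟨ cancelʳ uu⁻¹≈ε y ⟩
    y               ∎

  ∙-cancelˡ-unit : ∀ {u x y} → Unit u → u ∙ x ≈ u ∙ y → x ≈ y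
  ∙-cancelˡ-unit {u} {x} {y} unit ux≈uy =
    ∙-cancelʳ-unit unit (trans (comm x u) (trans ux≈uy (comm u y)))

  ^≈∏-of-factors : ∀ {n} (g : Carrier) (r h : Fin n → Carrier) (π : Fin n → Fin n) →
                   Injective _≡_ _≡_ π → (∀ i → g ∙ r i ≈ h i ∙ r (π i)) →
                   Unit (∏ r) → g ^ n ≈ ∏ h
  ^≈∏-of-factors {n} g r h π π-inj g-permutes unit = ∙-cancelʳ-unit unit (begin
    g ^ n ∙ ∏ r                 ≈⟨ ∙-congʳ (sum-replicate n) ⟨
    ∏ {n} (λ _ → g) ∙ ∏ r       ≈⟨ ∑-distrib-+ (λ _ → g) r ⟨
    ∏ (λ i → g ∙ r i)           ≈⟨ sum-cong-≋ g-permutes ⟩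
    ∏ (λ i → h i ∙ r (π i))     ≈⟨ ∑-distrib-+ h (λ i → r (π i)) ⟩
    ∏ h ∙ ∏ (λ i → r (π i))     ≈⟨ ∙-congˡ (sum-permute r (injective⇒permutation π π-inj)) ⟨
    ∏ h ∙ ∏ r                   ∎)

module FieldProperties {c ℓ} (F : Field c ℓ) where
  open Field F
  open CommutativeMonoidUnits *-commutativeMonoid public
  open SetoidReasoning setoid

  *-cancelˡ-≉0 : ∀ {s x y} → ¬ s ≈ 0# → s * x ≈ s * y → x ≈ y
  *-cancelˡ-≉0 {s} s≉0 = ∙-cancelˡ-unit (inverse s s≉0)

  *-≉0 : ∀ {x y} → ¬ x ≈ 0# → ¬ y ≈ 0# → ¬ x * y ≈ 0#
  *-≉0 {x} x≉0 y≉0 xy≈0 = y≉0 (*-cancelˡ-≉0 x≉0 (trans xy≈0 (sym (zeroʳ x))))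

  ^-#units≈1 : ∀ {n} (u : Fin n → Carrier) → (∀ i → ¬ u i ≈ 0#) →
               (∀ i j → u i ≈ u j → i ≡ j) → (∀ x → ¬ x ≈ 0# → ∃ λ i → u i ≈ x) →
               ∀ {g} → ¬ g ≈ 0# → g ^ n ≈ 1#
  ^-#units≈1 {n} u u≉0 u-inj u-onto {g} g≉0 = begin
    g ^ n                ≈⟨ ^≈∏-of-factors g u (λ _ → 1#) π π-inj g-permutes units-unit ⟩
    ∏ {n} (λ _ → 1#)     ≈⟨ ∏-replicate-ε n ⟩
    1#                   ∎
    where
    image : ∀ i → ∃ λ j → u j ≈ g * u i
    image i = u-onto (g * u i) (*-≉0 g≉0 (u≉0 i))
    π : Fin n → Fin n
    π i = proj₁ (image i)
    g-permutes : ∀ i → g * u i ≈ 1# * u (π i)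
    g-permutes i = trans (sym (proj₂ (image i))) (sym (*-identityˡ _))
    π-inj : Injective _≡_ _≡_ π
    π-inj {i} {j} πi≡πj = u-inj i j (*-cancelˡ-≉0 g≉0 (begin
      g * u i    ≈⟨ proj₂ (image i) ⟨
      u (π i)    ≡⟨ ≡.cong u πi≡πj ⟩
      u (π j)    ≈⟨ proj₂ (image j) ⟩
      g * u j    ∎))
    units-unit : Unit (∏ u)
    units-unit = unit-∏ u (λ i → inverse (u i) (u≉0 i))

  ^-card≈id : ∀ n (e : Fin n → Carrier) → (∀ i j → e i ≈ e j → i ≡ j) →
              (∀ x → ∃ λ i → e i ≈ x) → ∀ {g} → ¬ g ≈ 0# → g ^ n ≈ g
  ^-card≈id zero    e e-inj e-onto with () ← proj₁ (e-onto 0#)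
  ^-card≈id (suc n) e e-inj e-onto {g} g≉0 =
    trans (*-congˡ (^-#units≈1 u u≉0 u-inj u-onto g≉0)) (*-identityʳ g)
    where
    z : Fin (suc n)
    z = proj₁ (e-onto 0#)
    u : Fin n → Carrier
    u i = e (punchIn z i)
    u≉0 : ∀ i → ¬ u i ≈ 0#
    u≉0 i ui≈0 = punchInᵢ≢i z i (e-inj _ _ (trans ui≈0 (sym (proj₂ (e-onto 0#)))))
    u-inj : ∀ i j → u i ≈ u j → i ≡ j
    u-inj i j ui≈uj = punchIn-injective z i j (e-inj _ _ ui≈uj)
    u-onto : ∀ x → ¬ x ≈ 0# → ∃ λ i → u i ≈ x
    u-onto x x≉0 = punchOut z≢k , trans (reflexive (≡.cong e (punchIn-punchOut z≢k))) (proj₂ (e-onto x))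
      where
      k = proj₁ (e-onto x)
      z≢k : z ≢ k
      z≢k z≡k = x≉0 (begin
        x     ≈⟨ proj₂ (e-onto x) ⟨
        e k   ≡⟨ ≡.cong e z≡k ⟨
        e z   ≈⟨ proj₂ (e-onto 0#) ⟩
        0#    ∎)

module FiniteFieldProperties {c ℓ} (F : FiniteField c ℓ) where
  open FiniteField F
  open FieldProperties field′ public

  index : Carrier → Fin q
  index x = proj₁ (enum-surjective x)

  enum-index : ∀ x → enum (index x) ≈ x
  enum-index x = proj₂ (enum-surjective x)

  index-cong : ∀ {x y} → x ≈ y → index x ≡ index y
  index-cong {x} {y} x≈y = enum-injective _ _ (trans (enum-index x) (trans x≈y (sym (enum-index y))))

  index-enum : ∀ i → index (enum i) ≡ i
  index-enum i = enum-injective _ _ (enum-index (enum i))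

  _≟_ : Decidable _≈_
  x ≟ y with index x Fin.≟ index y
  ... | yes ix≡iy = yes (trans (sym (enum-index x)) (trans (reflexive (≡.cong enum ix≡iy)) (enum-index y)))
  ... | no  ix≢iy = no (ix≢iy ∘ index-cong)

  fermat : ∀ {g} → ¬ g ≈ 0# → g ^ q ≈ g
  fermat = ^-card≈id q enum enum-injective enum-surjective

  pow≡^ : ∀ x n → pow F x n ≡ x ^ n
  pow≡^ x zero    = ≡.refl
  pow≡^ x (suc n) = ≡.cong (x *_) (pow≡^ x n)

-- The pair (x , y) stands for x + y α in F[α]/(α² - a α - b).
module QuadraticAlgebra {c ℓ} (F : Field c ℓ) (a b : Field.Carrier F) where
  open Field F hiding (zero)
  open FieldProperties F
  open import Algebra.Properties.Ring ring using (-‿distribˡ-*; -‿distribʳ-*)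
  open import Algebra.Solver.Ring.NaturalCoefficients.Default commutativeSemiring
    using (solve; _:*_; _:+_; _:=_; con)
  open SetoidReasoning setoid

  K : Set c
  K = Carrier × Carrier

  infix 4 _≈ᴷ_
  _≈ᴷ_ : K → K → Set ℓ
  (x , y) ≈ᴷ (x′ , y′) = x ≈ x′ × y ≈ y′

  ≈ᴷ-isEquivalence : IsEquivalence _≈ᴷ_
  ≈ᴷ-isEquivalence = ×-isEquivalence isEquivalence isEquivalence

  module ≈ᴷ = IsEquivalence ≈ᴷ-isEquivalence

  infixl 7 _*ᴷ_
  _*ᴷ_ : K → K → K
  (x , y) *ᴷ (x′ , y′) = (x * x′ + b * (y * y′) , x * y′ + x′ * y + a * (y * y′))

  1ᴷ : K
  1ᴷ = (1# , 0#)

  *ᴷ-cong : ∀ {z z′ w w′} → z ≈ᴷ z′ → w ≈ᴷ w′ → z *ᴷ w ≈ᴷ z′ *ᴷ w′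
  *ᴷ-cong (x≈ , y≈) (x′≈ , y′≈) =
    +-cong (*-cong x≈ x′≈) (*-congˡ (*-cong y≈ y′≈)) ,
    +-cong (+-cong (*-cong x≈ y′≈) (*-cong x′≈ y≈)) (*-congˡ (*-cong y≈ y′≈))

  *ᴷ-assoc : ∀ z w u → (z *ᴷ w) *ᴷ u ≈ᴷ z *ᴷ (w *ᴷ u)
  *ᴷ-assoc (x₁ , y₁) (x₂ , y₂) (x₃ , y₃) =
    solve 8 (λ a b x₁ y₁ x₂ y₂ x₃ y₃ →
      (x₁ :* x₂ :+ b :* (y₁ :* y₂)) :* x₃ :+ b :* ((x₁ :* y₂ :+ x₂ :* y₁ :+ a :* (y₁ :* y₂)) :* y₃)
      := x₁ :* (x₂ :* x₃ :+ b :* (y₂ :* y₃)) :+ b :* (y₁ :* (x₂ :* y₃ :+ x₃ :* y₂ :+ a :* (y₂ :* y₃))))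
      refl a b x₁ y₁ x₂ y₂ x₃ y₃ ,
    solve 8 (λ a b x₁ y₁ x₂ y₂ x₃ y₃ →
      (x₁ :* x₂ :+ b :* (y₁ :* y₂)) :* y₃ :+ x₃ :* (x₁ :* y₂ :+ x₂ :* y₁ :+ a :* (y₁ :* y₂))
        :+ a :* ((x₁ :* y₂ :+ x₂ :* y₁ :+ a :* (y₁ :* y₂)) :* y₃)
      := x₁ :* (x₂ :* y₃ :+ x₃ :* y₂ :+ a :* (y₂ :* y₃)) :+ (x₂ :* x₃ :+ b :* (y₂ :* y₃)) :* y₁
        :+ a :* (y₁ :* (x₂ :* y₃ :+ x₃ :* y₂ :+ a :* (y₂ :* y₃))))
      refl a b x₁ y₁ x₂ y₂ x₃ y₃

  *ᴷ-comm : ∀ z w → z *ᴷ w ≈ᴷ w *ᴷ z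
  *ᴷ-comm (x₁ , y₁) (x₂ , y₂) =
    +-cong (*-comm x₁ x₂) (*-congˡ (*-comm y₁ y₂)) ,
    +-cong (+-comm _ _) (*-congˡ (*-comm y₁ y₂))

  *ᴷ-identityˡ : ∀ z → 1ᴷ *ᴷ z ≈ᴷ z
  *ᴷ-identityˡ (x , y) =
    solve 3 (λ b x y → con 1 :* x :+ b :* (con 0 :* y) := x) refl b x y ,
    solve 3 (λ a x y → con 1 :* y :+ x :* con 0 :+ a :* (con 0 :* y) := y) refl a x y

  K-commutativeMonoid : CommutativeMonoid c ℓ
  K-commutativeMonoid = record
    { Carrier = K ; _≈_ = _≈ᴷ_ ; _∙_ = _*ᴷ_ ; ε = 1ᴷ
    ; isCommutativeMonoid = record
      { isMonoid = record
        { isSemigroup = record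
          { isMagma = record { isEquivalence = ≈ᴷ-isEquivalence ; ∙-cong = *ᴷ-cong }
          ; assoc = *ᴷ-assoc }
        ; identity = *ᴷ-identityˡ , λ z → ≈ᴷ.trans (*ᴷ-comm z 1ᴷ) (*ᴷ-identityˡ z) }
      ; comm = *ᴷ-comm } }

  module Kᵘ = CommutativeMonoidUnits K-commutativeMonoid
  module ≈ᴷ-Reasoning = SetoidReasoning (CommutativeMonoid.setoid K-commutativeMonoid)
  open Kᵘ public using () renaming (_^_ to _^ᴷ_; ∏ to ∏ᴷ; Unit to Unitᴷ)

  α : K
  α = (0# , 1#)

  scalar : Carrier → K
  scalar x = (x , 0#)

  α-*ᴷ : ∀ x y → α *ᴷ (x , y) ≈ᴷ (b * y , x + a * y)
  α-*ᴷ x y =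
    solve 3 (λ b x y → con 0 :* x :+ b :* (con 1 :* y) := b :* y) refl b x y ,
    solve 3 (λ a x y → con 0 :* y :+ x :* con 1 :+ a :* (con 1 :* y) := x :+ a :* y) refl a x y

  infixr 7 _·ᴷ_
  _·ᴷ_ : Carrier → K → K
  s ·ᴷ (x , y) = (s * x , s * y)

  scalar-*ᴷ : ∀ s z → scalar s *ᴷ z ≈ᴷ s ·ᴷ z
  scalar-*ᴷ s (x , y) =
    solve 4 (λ b s x y → s :* x :+ b :* (con 0 :* y) := s :* x) refl b s x y ,
    solve 4 (λ a s x y → s :* y :+ x :* con 0 :+ a :* (con 0 :* y) := s :* y) refl a s x y

  scalar-cong : ∀ {x y} → x ≈ y → scalar x ≈ᴷ scalar y
  scalar-cong x≈y = x≈y , refl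

  scalar-* : ∀ x y → scalar (x * y) ≈ᴷ scalar x *ᴷ scalar y
  scalar-* x y = ≈ᴷ.sym (≈ᴷ.trans (scalar-*ᴷ x (y , 0#)) (refl , zeroʳ x))

  scalar-^ : ∀ x n → scalar (x ^ n) ≈ᴷ scalar x ^ᴷ n
  scalar-^ x zero    = ≈ᴷ.refl
  scalar-^ x (suc n) = ≈ᴷ.trans (scalar-* x (x ^ n)) (*ᴷ-cong ≈ᴷ.refl (scalar-^ x n))

  scalar-∏ : ∀ {n} (f : Fin n → Carrier) → scalar (∏ f) ≈ᴷ ∏ᴷ (scalar ∘ f)
  scalar-∏ {zero}  f = ≈ᴷ.refl
  scalar-∏ {suc n} f = ≈ᴷ.trans (scalar-* (f zero) _) (*ᴷ-cong ≈ᴷ.refl (scalar-∏ (f ∘ suc)))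

  scalar-unit : ∀ {x} → Unit x → Unitᴷ (scalar x)
  scalar-unit {x} (x⁻¹ , xx⁻¹≈1) = scalar x⁻¹ , ≈ᴷ.trans (≈ᴷ.sym (scalar-* x x⁻¹)) (scalar-cong xx⁻¹≈1)

  norm : K → Carrier
  norm (x , y) = x * x + a * (x * y) + - b * (y * y)

  norm-cong : ∀ {z w} → z ≈ᴷ w → norm z ≈ norm w
  norm-cong (x≈ , y≈) = +-cong (+-cong (*-cong x≈ x≈) (*-congˡ (*-cong x≈ y≈))) (*-congˡ (*-cong y≈ y≈))

  norm-scalar : ∀ x → norm (scalar x) ≈ x * x
  norm-scalar x =
    solve 3 (λ a n x → x :* x :+ a :* (x :* con 0) :+ n :* (con 0 :* con 0) := x :* x) refl a (- b) x

  norm-1ᴷ : norm 1ᴷ ≈ 1#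
  norm-1ᴷ = trans (norm-scalar 1#) (*-identityˡ 1#)

  norm-α : norm α ≈ - b
  norm-α =
    solve 2 (λ a n → con 0 :* con 0 :+ a :* (con 0 :* con 1) :+ n :* (con 1 :* con 1) := n) refl a (- b)

  -- As a polynomial identity in b and n = - b, the two sides differ by a multiple of b + n.
  norm-α*ᴷ : ∀ z → norm (α *ᴷ z) ≈ - b * norm z
  norm-α*ᴷ (x , y) = trans (norm-cong (α-*ᴷ x y)) (begin
    N′                               ≈⟨ +-identityʳ N′ ⟨
    N′ + 0#                          ≈⟨ +-congˡ ([b-b]*s≈0 (- b * (y * y))) ⟨
    N′ + (b + - b) * (- b * (y * y)) ≈⟨ solve 5 (λ a b n x y →
        (b :* y) :* (b :* y) :+ a :* ((b :* y) :* (x :+ a :* y)) :+ n :* ((x :+ a :* y) :* (x :+ a :* y))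
          :+ (b :+ n) :* (n :* (y :* y))
        := n :* (x :* x :+ a :* (x :* y) :+ n :* (y :* y))
          :+ (b :+ n) :* (b :* (y :* y) :+ a :* (x :* y) :+ a :* a :* (y :* y)))
        refl a b (- b) x y ⟩
    N + (b + - b) * S                ≈⟨ +-congˡ ([b-b]*s≈0 S) ⟩
    N + 0#                           ≈⟨ +-identityʳ N ⟩
    N                                ∎)
    where
    N′ = norm (b * y , x + a * y)
    N  = - b * norm (x , y)
    S  = b * (y * y) + a * (x * y) + a * a * (y * y)
    [b-b]*s≈0 : ∀ s → (b + - b) * s ≈ 0#
    [b-b]*s≈0 s = trans (*-congʳ (-‿inverseʳ b)) (zeroˡ s)

  norm-α^ : ∀ n → norm (α ^ᴷ n) ≈ (- b) ^ n
  norm-α^ zero    = norm-1ᴷ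
  norm-α^ (suc n) = trans (norm-α*ᴷ (α ^ᴷ n)) (*-congˡ (norm-α^ n))

  -- x + y ᾱ, where ᾱ = a - α is the other root of x² - a x - b.
  conj : K → K
  conj (x , y) = (x + a * y , - y)

  *ᴷ-conj : ∀ z → z *ᴷ conj z ≈ᴷ scalar (norm z)
  *ᴷ-conj (x , y) = constant , linear
    where
    constant : x * (x + a * y) + b * (y * - y) ≈ norm (x , y)
    constant = begin
      x * (x + a * y) + b * (y * - y)   ≈⟨ +-congˡ (*-congˡ (-‿distribʳ-* y y)) ⟨
      x * (x + a * y) + b * - (y * y)   ≈⟨ +-congˡ (trans (sym (-‿distribˡ-* b _)) (-‿distribʳ-* b _)) ⟨
      x * (x + a * y) + - b * (y * y)   ≈⟨ +-congʳ (solve 3 (λ a x y →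
                                              x :* (x :+ a :* y) := x :* x :+ a :* (x :* y)) refl a x y) ⟩
      norm (x , y)                      ∎
    linear : x * - y + (x + a * y) * y + a * (y * - y) ≈ 0#
    linear = begin
      x * - y + (x + a * y) * y + a * (y * - y)  ≈⟨ solve 4 (λ a x y m →
          x :* m :+ (x :+ a :* y) :* y :+ a :* (y :* m) := (x :+ a :* y) :* (y :+ m)) refl a x y (- y) ⟩
      (x + a * y) * (y + - y)                    ≈⟨ *-congˡ (-‿inverseʳ y) ⟩
      (x + a * y) * 0#                           ≈⟨ zeroʳ _ ⟩
      0#                                         ∎

  norm≉0⇒unit : ∀ z → ¬ norm z ≈ 0# → Unitᴷ z
  norm≉0⇒unit z Nz≉0 = Kᵘ.factor-of-unit (*ᴷ-conj z) (scalar-unit (inverse (norm z) Nz≉0))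

  unit⇒≉0ᴷ : ∀ {z} → Unitᴷ z → ¬ z ≈ᴷ (0# , 0#)
  unit⇒≉0ᴷ {z} ((w₁ , w₂) , zw≈1) z≈0 = 1≉0 (begin
    1#                           ≈⟨ proj₁ zw≈1 ⟨
    proj₁ (z *ᴷ (w₁ , w₂))       ≈⟨ proj₁ (*ᴷ-cong z≈0 ≈ᴷ.refl) ⟩
    0# * w₁ + b * (0# * w₂)      ≈⟨ +-cong (zeroˡ w₁) (trans (*-congˡ (zeroˡ w₂)) (zeroʳ b)) ⟩
    0# + 0#                      ≈⟨ +-identityʳ 0# ⟩
    0#                           ∎)

module QuadraticAlgebraLines {c ℓ} (F : FiniteField c ℓ) {a b : FiniteField.Carrier F}
  (b≉0 : ¬ FiniteField._≈_ F b (FiniteField.0# F)) (irreducible : Irreducible-x²-ax-b F a b) where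
  open FiniteField F hiding (zero)
  open FiniteFieldProperties F
  open QuadraticAlgebra field′ a b
  open import Algebra.Properties.Ring ring
    using (-‿distribʳ-*; -‿involutive; -0#≈0#; +-inverseˡ-unique; -‿+-comm)
  open import Algebra.Properties.CommutativeSemigroup *-commutativeSemigroup using (x∙yz≈y∙xz)
  open SetoidReasoning setoid

  -b≉0 : ¬ - b ≈ 0#
  -b≉0 -b≈0 = b≉0 (trans (sym (-‿involutive b)) (trans (-‿cong -b≈0) -0#≈0#))

  -- A root t of x² + a x - b would give the factorisation (x + t)(x - (a + t)) of x² - a x - b.
  norm[t,1]≉0 : ∀ t → ¬ norm (t , 1#) ≈ 0#
  norm[t,1]≉0 t N≈0 = irreducible (1# , t , 1# , - (a + t) , 1≉0 , 1≉0 , *-identityˡ 1# , linear , constant)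
    where
    root : t * t + a * (t * 1#) ≈ b
    root = trans (+-inverseˡ-unique _ _ N≈0) (trans (-‿cong (*-congˡ (*-identityˡ 1#)))
                 (trans (-‿cong (*-identityʳ (- b))) (-‿involutive b)))
    linear : 1# * - (a + t) + t * 1# ≈ - a
    linear = begin
      1# * - (a + t) + t * 1#   ≈⟨ +-cong (*-identityˡ _) (*-identityʳ t) ⟩
      - (a + t) + t             ≈⟨ +-congʳ (-‿+-comm a t) ⟨
      - a + - t + t             ≈⟨ +-assoc (- a) (- t) t ⟩
      - a + (- t + t)           ≈⟨ +-congˡ (-‿inverseˡ t) ⟩
      - a + 0#                  ≈⟨ +-identityʳ (- a) ⟩
      - a                       ∎
    constant : t * - (a + t) ≈ - b
    constant = begin
      t * - (a + t)             ≈⟨ -‿distribʳ-* t (a + t) ⟨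
      - (t * (a + t))           ≈⟨ -‿cong (trans (distribˡ t a t) (trans (+-comm _ _) (+-congˡ (*-comm t a)))) ⟩
      - (t * t + a * t)         ≈⟨ -‿cong (trans (+-congˡ (*-congˡ (sym (*-identityʳ t)))) root) ⟩
      - b                       ∎

  -- 1 and the t + α (t ∈ F) represent the q + 1 lines through the origin of K ≅ F².
  line : Fin (suc q) → K
  line zero    = 1ᴷ
  line (suc t) = (enum t , 1#)

  line-unit : ∀ i → Unitᴷ (line i)
  line-unit zero    = norm≉0⇒unit 1ᴷ (λ N≈0 → 1≉0 (trans (sym norm-1ᴷ) N≈0))
  line-unit (suc t) = norm≉0⇒unit (line (suc t)) (norm[t,1]≉0 (enum t))

  on-line : ∀ z → ¬ z ≈ᴷ (0# , 0#) → ∃₂ λ k s → ¬ s ≈ 0# × z ≈ᴷ scalar s *ᴷ line k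
  on-line (x , y) z≉0 with y ≟ 0#
  ... | yes y≈0 = zero , x , (λ x≈0 → z≉0 (x≈0 , y≈0)) ,
                  ≈ᴷ.sym (≈ᴷ.trans (scalar-*ᴷ x 1ᴷ) (*-identityʳ x , trans (zeroʳ x) (sym y≈0)))
  ... | no  y≉0 = suc (index (x * y⁻¹)) , y , y≉0 ,
                  ≈ᴷ.sym (≈ᴷ.trans (scalar-*ᴷ y (enum (index (x * y⁻¹)) , 1#)) (y*[x/y]≈x , *-identityʳ y))
    where
    y⁻¹ = proj₁ (inverse y y≉0)
    y*[x/y]≈x : y * enum (index (x * y⁻¹)) ≈ x
    y*[x/y]≈x = begin
      y * enum (index (x * y⁻¹))  ≈⟨ *-congˡ (enum-index _) ⟩
      y * (x * y⁻¹)               ≈⟨ x∙yz≈y∙xz y x y⁻¹ ⟩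
      x * (y * y⁻¹)               ≈⟨ *-congˡ (proj₂ (inverse y y≉0)) ⟩
      x * 1#                      ≈⟨ *-identityʳ x ⟩
      x                           ∎

  scaled-line-injective : ∀ {s s′} i j → ¬ s ≈ 0# → scalar s *ᴷ line i ≈ᴷ scalar s′ *ᴷ line j → i ≡ j
  scaled-line-injective {s} {s′} i j s≉0 eq =
    compare i j (≈ᴷ.trans (≈ᴷ.sym (scalar-*ᴷ s (line i))) (≈ᴷ.trans eq (scalar-*ᴷ s′ (line j))))
    where
    s*1≉0 : ¬ s * 1# ≈ 0#
    s*1≉0 s*1≈0 = s≉0 (trans (sym (*-identityʳ s)) s*1≈0)
    compare : ∀ i j → s ·ᴷ line i ≈ᴷ s′ ·ᴷ line j → i ≡ j
    compare zero    zero     _         = ≡.refl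
    compare zero    (suc t′) (e₁ , e₂) = ⊥-elim (s*1≉0 (trans e₁ (trans (*-congʳ s′≈0) (zeroˡ _))))
      where
      s′≈0 : s′ ≈ 0#
      s′≈0 = trans (sym (*-identityʳ s′)) (trans (sym e₂) (zeroʳ s))
    compare (suc t) zero     (e₁ , e₂) = ⊥-elim (s*1≉0 (trans e₂ (zeroʳ s′)))
    compare (suc t) (suc t′) (e₁ , e₂) = ≡.cong suc (enum-injective t t′ (*-cancelˡ-≉0 s≉0 (begin
      s * enum t    ≈⟨ e₁ ⟩
      s′ * enum t′  ≈⟨ *-congʳ s′≈s ⟩
      s * enum t′   ∎)))
      where
      s′≈s : s′ ≈ s
      s′≈s = trans (sym (*-identityʳ s′)) (trans (sym e₂) (*-identityʳ s))

module ScalarPowerOfα {c ℓ} (F : FiniteField c ℓ) {a b : FiniteField.Carrier F}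
  (b≉0 : ¬ FiniteField._≈_ F b (FiniteField.0# F)) (irreducible : Irreducible-x²-ax-b F a b) where
  open FiniteField F hiding (zero)
  open FiniteFieldProperties F
  open QuadraticAlgebra field′ a b
  open QuadraticAlgebraLines F b≉0 irreducible
  open import Algebra.Properties.CommutativeSemigroup (CommutativeMonoid.commutativeSemigroup K-commutativeMonoid)
    using (x∙yz≈y∙xz)
  open import Algebra.Properties.Ring ring using (-‿distribˡ-*; -‿distribʳ-*; -‿involutive)

  α-unit : Unitᴷ α
  α-unit = norm≉0⇒unit α (λ Nα≈0 → -b≉0 (trans (sym norm-α) Nα≈0))

  α-moves-line : ∀ i → ∃₂ λ k s → ¬ s ≈ 0# × α *ᴷ line i ≈ᴷ scalar s *ᴷ line k
  α-moves-line i = on-line (α *ᴷ line i) (unit⇒≉0ᴷ (Kᵘ.unit-∙ α-unit (line-unit i)))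

  α-line : Fin (suc q) → Fin (suc q)
  α-line i = proj₁ (α-moves-line i)

  α-factor : Fin (suc q) → Carrier
  α-factor i = proj₁ (proj₂ (α-moves-line i))

  α-factor≉0 : ∀ i → ¬ α-factor i ≈ 0#
  α-factor≉0 i = proj₁ (proj₂ (proj₂ (α-moves-line i)))

  α-*ᴷ-line : ∀ i → α *ᴷ line i ≈ᴷ scalar (α-factor i) *ᴷ line (α-line i)
  α-*ᴷ-line i = proj₂ (proj₂ (proj₂ (α-moves-line i)))

  α-line-injective : Injective _≡_ _≡_ α-line
  α-line-injective {i} {j} αi≡αj =
    scaled-line-injective i j (α-factor≉0 j) (Kᵘ.∙-cancelˡ-unit α-unit (begin
      α *ᴷ (scalar sⱼ *ᴷ line i)                  ≈⟨ x∙yz≈y∙xz α (scalar sⱼ) (line i) ⟩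
      scalar sⱼ *ᴷ (α *ᴷ line i)                  ≈⟨ *ᴷ-cong ≈ᴷ.refl (α-*ᴷ-line i) ⟩
      scalar sⱼ *ᴷ (scalar sᵢ *ᴷ line (α-line i)) ≈⟨ x∙yz≈y∙xz (scalar sⱼ) (scalar sᵢ) _ ⟩
      scalar sᵢ *ᴷ (scalar sⱼ *ᴷ line (α-line i)) ≡⟨ ≡.cong (λ k → scalar sᵢ *ᴷ (scalar sⱼ *ᴷ line k)) αi≡αj ⟩
      scalar sᵢ *ᴷ (scalar sⱼ *ᴷ line (α-line j)) ≈⟨ *ᴷ-cong ≈ᴷ.refl (α-*ᴷ-line j) ⟨
      scalar sᵢ *ᴷ (α *ᴷ line j)                  ≈⟨ x∙yz≈y∙xz (scalar sᵢ) α (line j) ⟩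
      α *ᴷ (scalar sᵢ *ᴷ line j)                  ∎))
    where
    open ≈ᴷ-Reasoning
    sᵢ = α-factor i
    sⱼ = α-factor j

  α^[q+1]≈scalar : α ^ᴷ suc q ≈ᴷ scalar (∏ α-factor)
  α^[q+1]≈scalar = ≈ᴷ.trans
    (Kᵘ.^≈∏-of-factors α line (scalar ∘ α-factor) α-line α-line-injective α-*ᴷ-line (Kᵘ.unit-∏ line line-unit))
    (≈ᴷ.sym (scalar-∏ α-factor))

  ∏α-factor-square : ∏ α-factor * ∏ α-factor ≈ b * b
  ∏α-factor-square = begin
    H * H                  ≈⟨ norm-scalar H ⟨
    norm (scalar H)        ≈⟨ norm-cong α^[q+1]≈scalar ⟨
    norm (α ^ᴷ suc q)      ≈⟨ norm-α^ (suc q) ⟩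
    - b * (- b) ^ q        ≈⟨ *-congˡ (fermat -b≉0) ⟩
    - b * - b              ≈⟨ -‿distribˡ-* b (- b) ⟨
    - (b * - b)            ≈⟨ -‿cong (-‿distribʳ-* b b) ⟨
    - - (b * b)            ≈⟨ -‿involutive (b * b) ⟩
    b * b                  ∎
    where
    open SetoidReasoning setoid
    H = ∏ α-factor

  ∏α-factor^[2m]≈1 : ∀ m → pow F (b * b) m ≈ 1# → ∏ α-factor ^ (2 ℕ.* m) ≈ 1#
  ∏α-factor^[2m]≈1 m [b²]^m≈1 = begin
    H ^ (2 ℕ.* m)     ≈⟨ ^-assocʳ H 2 m ⟨
    (H ^ 2) ^ m       ≈⟨ ^-congˡ m (trans (*-congˡ (*-identityʳ H)) ∏α-factor-square) ⟩
    (b * b) ^ m       ≡⟨ pow≡^ (b * b) m ⟨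
    pow F (b * b) m   ≈⟨ [b²]^m≈1 ⟩
    1#                ∎
    where
    open SetoidReasoning setoid
    H = ∏ α-factor

  α-period : ∀ m → IsMultOrder F (b * b) m → α ^ᴷ (suc q ℕ.* (2 ℕ.* m)) ≈ᴷ 1ᴷ
  α-period m (_ , [b²]^m≈1 , _) = begin
    α ^ᴷ (suc q ℕ.* (2 ℕ.* m))             ≈⟨ Kᵘ.^-assocʳ α (suc q) (2 ℕ.* m) ⟨
    (α ^ᴷ suc q) ^ᴷ (2 ℕ.* m)              ≈⟨ Kᵘ.^-congˡ (2 ℕ.* m) α^[q+1]≈scalar ⟩
    scalar (∏ α-factor) ^ᴷ (2 ℕ.* m)       ≈⟨ scalar-^ (∏ α-factor) (2 ℕ.* m) ⟨
    scalar (∏ α-factor ^ (2 ℕ.* m))        ≈⟨ scalar-cong (∏α-factor^[2m]≈1 m [b²]^m≈1) ⟩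
    1ᴷ                                     ∎
    where open ≈ᴷ-Reasoning

module CompanionMatrix {c ℓ} (F : FiniteField c ℓ) (a b : FiniteField.Carrier F) where
  open FiniteField F hiding (zero)
  open FieldProperties field′ using (*-cancelˡ-≉0)
  open QuadraticAlgebra field′ a b

  toK : Vec2 F → K
  toK (x , y) = (b * y , x)

  toK-Qmul : ∀ v → toK (Qmul F a b v) ≈ᴷ α *ᴷ toK v
  toK-Qmul (x , y) = ≈ᴷ.sym (≈ᴷ.trans (α-*ᴷ (b * y) x) (refl , +-comm (b * y) (a * x)))

  toK-Qpow : ∀ n v → toK (Qpow F a b n v) ≈ᴷ α ^ᴷ n *ᴷ toK v
  toK-Qpow zero    v = ≈ᴷ.sym (*ᴷ-identityˡ (toK v))
  toK-Qpow (suc n) v = ≈ᴷ.trans (toK-Qmul (Qpow F a b n v))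
    (≈ᴷ.trans (*ᴷ-cong ≈ᴷ.refl (toK-Qpow n v)) (≈ᴷ.sym (*ᴷ-assoc α (α ^ᴷ n) (toK v))))

  toK-injective : ¬ b ≈ 0# → ∀ {v w} → toK v ≈ᴷ toK w → _≈₂_ F v w
  toK-injective b≉0 (by≈by′ , x≈x′) = x≈x′ , *-cancelˡ-≉0 b≉0 by≈by′

  Qpow-period : ¬ b ≈ 0# → ∀ T → α ^ᴷ T ≈ᴷ 1ᴷ → ∀ v → _≈₂_ F (Qpow F a b T v) v
  Qpow-period b≉0 T α^T≈1 v = toK-injective b≉0
    (≈ᴷ.trans (toK-Qpow T v) (≈ᴷ.trans (*ᴷ-cong α^T≈1 ≈ᴷ.refl) (*ᴷ-identityˡ (toK v))))

module OrbitCounting {c ℓ} (F : FiniteField c ℓ) (a b : FiniteField.Carrier F)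
  (T : ℕ) .{{_ : NonZero T}} (period : ∀ v → _≈₂_ F (Qpow F a b T v) v) where
  open FiniteField F using (field′; q; enum; 0#; +-cong; *-congˡ)
  open FiniteFieldProperties F using (index; index-cong; index-enum; _≟_)
  open QuadraticAlgebra field′ a b using ()
    renaming (module ≈ᴷ to ≈ᵛ; module ≈ᴷ-Reasoning to ≈ᵛ-Reasoning)

  infix 4 _≈ᵛ_
  _≈ᵛ_ : Vec2 F → Vec2 F → Set ℓ
  _≈ᵛ_ = _≈₂_ F

  Q^ : ℕ → Vec2 F → Vec2 F
  Q^ = Qpow F a b

  Q^-+ : ∀ m n v → Q^ (m ℕ.+ n) v ≡ Q^ m (Q^ n v)
  Q^-+ zero    n v = ≡.refl
  Q^-+ (suc m) n v = ≡.cong (Qmul F a b) (Q^-+ m n v)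

  Qmul-cong : ∀ {v w} → v ≈ᵛ w → Qmul F a b v ≈ᵛ Qmul F a b w
  Qmul-cong (x≈ , y≈) = +-cong (*-congˡ x≈) (*-congˡ y≈) , x≈

  Q^-cong : ∀ n {v w} → v ≈ᵛ w → Q^ n v ≈ᵛ Q^ n w
  Q^-cong zero    = λ v≈w → v≈w
  Q^-cong (suc n) = Qmul-cong ∘ Q^-cong n

  Q^-*T : ∀ k v → Q^ (k ℕ.* T) v ≈ᵛ v
  Q^-*T zero    v = ≈ᵛ.refl
  Q^-*T (suc k) v rewrite Q^-+ T (k ℕ.* T) v = ≈ᵛ.trans (period _) (Q^-*T k v)

  Q^-%T : ∀ n v → Q^ (n % T) v ≈ᵛ Q^ n v
  Q^-%T n v = begin
    Q^ (n % T) v                      ≈⟨ Q^-cong (n % T) (Q^-*T (n / T) v) ⟨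
    Q^ (n % T) (Q^ (n / T ℕ.* T) v)   ≡⟨ Q^-+ (n % T) (n / T ℕ.* T) v ⟨
    Q^ (n % T ℕ.+ n / T ℕ.* T) v      ≡⟨ ≡.cong (λ k → Q^ k v) (m≡m%n+[m/n]*n n T) ⟨
    Q^ n v                            ∎
    where open ≈ᵛ-Reasoning

  -- Q^(n (T - 1)) undoes Q^n, which turns orbits under ⟨Q⟩ into forward orbits.
  InOrbit⇒Q^<T : ∀ {v w} → InOrbit F a b v w → ∃ λ n → n < T × Q^ n v ≈ᵛ w
  InOrbit⇒Q^<T {v} {w} (n , inj₁ Qⁿv≈w) = n % T , m%n<n n T , ≈ᵛ.trans (Q^-%T n v) Qⁿv≈w
  InOrbit⇒Q^<T {v} {w} (n , inj₂ Qⁿw≈v) = m % T , m%n<n m T , (begin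
    Q^ (m % T) v          ≈⟨ Q^-%T m v ⟩
    Q^ m v                ≈⟨ Q^-cong m Qⁿw≈v ⟨
    Q^ m (Q^ n w)         ≡⟨ Q^-+ m n w ⟨
    Q^ (m ℕ.+ n) w        ≡⟨ ≡.cong (λ k → Q^ k w) m+n≡n*T ⟩
    Q^ (n ℕ.* T) w        ≈⟨ Q^-*T n w ⟩
    w                     ∎)
    where
    open ≈ᵛ-Reasoning
    m = n ℕ.* (T ∸ 1)
    m+n≡n*T : m ℕ.+ n ≡ n ℕ.* T
    m+n≡n*T = ≡.trans (≡.cong (m ℕ.+_) (≡.sym (ℕₚ.*-identityʳ n)))
      (≡.trans (≡.sym (ℕₚ.*-distribˡ-+ n (T ∸ 1) 1)) (≡.cong (n ℕ.*_) (ℕₚ.m∸n+n≡m (ℕ.>-nonZero⁻¹ T))))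

  encode : Vec2 F → Fin (q ℕ.* q)
  encode (x , y) = combine (index x) (index y)

  encode-cong : ∀ {v w} → v ≈ᵛ w → encode v ≡ encode w
  encode-cong (x≈ , y≈) = ≡.cong₂ combine (index-cong x≈) (index-cong y≈)

  encode-surjective : ∀ p → ∃ λ w → encode w ≡ p
  encode-surjective p with j , k , combine[j,k]≡p ← combine-surjective p =
    (enum j , enum k) , ≡.trans (≡.cong₂ combine (index-enum j) (index-enum k)) combine[j,k]≡p

  module _ {L : List (Vec2 F)} (representatives : OrbitRepresentatives F a b L) where
    open OrbitRepresentatives representatives using (covers)

    orbit-point : Fin (length L) × Fin T → Vec2 F
    orbit-point (i , r) = Q^ (toℕ r) (lookup L i)

    listed : Fin (suc (length L ℕ.* T)) → Vec2 F
    listed zero    = (0# , 0#)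
    listed (suc k) = orbit-point (remQuot T k)

    listed-onto : ∀ w → ∃ λ k → listed k ≈ᵛ w
    listed-onto w with (proj₁ w ≟ 0#) ×-dec (proj₂ w ≟ 0#)
    ... | yes w≈0 = zero , ≈ᵛ.sym w≈0
    ... | no  w≉0 with v , v∈L , v~w ← covers w w≉0
                  with n , n<T , Qⁿv≈w ← InOrbit⇒Q^<T v~w =
      suc (combine (Any.index v∈L) (fromℕ< n<T)) , ≈ᵛ.trans (≈ᵛ.reflexive listed≡Qⁿv) Qⁿv≈w
      where
      listed≡Qⁿv : listed (suc (combine (Any.index v∈L) (fromℕ< n<T))) ≡ Q^ n v
      listed≡Qⁿv = ≡.trans (≡.cong orbit-point (remQuot-combine (Any.index v∈L) (fromℕ< n<T)))
        (≡.cong₂ Q^ (toℕ-fromℕ< n<T) (≡.sym (lookup-index v∈L)))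

    #vectors≤ : q ℕ.* q ≤ suc (length L ℕ.* T)
    #vectors≤ = surjective⇒≤ (encode ∘ listed) λ p →
      let (w , encode[w]≡p) = encode-surjective p
          (k , listed[k]≈w) = listed-onto w
      in k , ≡.trans (encode-cong listed[k]≈w) encode[w]≡p

-- q² - 1 = (q - 1)(q + 1), so the factor q + 1 cancels.
q*q≤1+l*[1+q]*k⇒q∸1≤k*l : ∀ q k l → q ℕ.* q ≤ suc (l ℕ.* (suc q ℕ.* k)) → q ∸ 1 ≤ k ℕ.* l
q*q≤1+l*[1+q]*k⇒q∸1≤k*l zero    k l _   = z≤n
q*q≤1+l*[1+q]*k⇒q∸1≤k*l (suc p) k l q²≤ =
  ℕₚ.*-cancelʳ-≤ p (k ℕ.* l) (2 ℕ.+ p)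
    (s≤s⁻¹ (≡.subst₂ _≤_ (square p) (≡.cong suc (rearrange p k l)) q²≤))
  where
  square : ∀ p → suc p ℕ.* suc p ≡ suc (p ℕ.* (2 ℕ.+ p))
  square = solve-∀
  rearrange : ∀ p k l → l ℕ.* ((2 ℕ.+ p) ℕ.* k) ≡ k ℕ.* l ℕ.* (2 ℕ.+ p)
  rearrange = solve-∀

mainTheorem20 : ∀ {c ℓ : Level} (F : FiniteField c ℓ) →
    let open FiniteField F in
    (a b : Carrier) → ¬ (b ≈ 0#) → Irreducible-x²-ax-b F a b →
    (m : ℕ) → IsMultOrder F (b * b) m →
    (L : List (Vec2 F)) → OrbitRepresentatives F a b L →
    q ∸ 1 ≤ 2 ℕ.* m ℕ.* length L
mainTheorem20 F a b b≉0 irreducible m order L representatives =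
  q*q≤1+l*[1+q]*k⇒q∸1≤k*l q (2 ℕ.* m) (length L) (#vectors≤ representatives)
  where
  open FiniteField F using (q)
  T = suc q ℕ.* (2 ℕ.* m)
  instance
    m≢0 : NonZero m
    m≢0 = ℕ.>-nonZero (proj₁ order)
    T≢0 : NonZero T
    T≢0 = ℕₚ.m*n≢0 (suc q) (2 ℕ.* m) {{_}} {{ℕₚ.m*n≢0 2 m}}
  Q^T≈id : ∀ v → _≈₂_ F (Qpow F a b T v) v
  Q^T≈id = CompanionMatrix.Qpow-period F a b b≉0 T (ScalarPowerOfα.α-period F b≉0 irreducible m order)
  open OrbitCounting F a b T Q^T≈id
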